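{- For all integers $L \geq 0$ and $n \geq 0$, \[ g^{L}(n) \leq 2\cdot (n/2)^{1/2^{L}}, \] where $g^L$ denotes the $L$-fold composition of $g$ (with $g^0(n) = n$).
   Context: $f(n) = \lceil (-1+\sqrt{1+8n})/2 \rceil$ and $g(n) = f(n)(f(n)+1)/2 - n$ for integers $n \ge 0$. -}

module Defs where

open import Data.Nat using (ℕ; zero; suc; _+_; _*_; _∸_; _^_; _≤?_)
open import Data.Nat.DivMod using (_/_)
open import Relation.Nullary using (yes; no)

-- f(n) = ⌈(-1 + √(1+8n))/2⌉.  For k ∈ ℕ:  (-1+√(1+8n))/2 ≤ k  ⇔  1+8n ≤ (2k+1)^2,
-- so f(n) is the least k ∈ ℕ with 1 + 8n ≤ (2k+1)^2 (and such k ≤ n always exists).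
-- searchF fuel k n returns the least j ≥ k (within fuel steps) with 1 + 8n ≤ (2j+1)^2.
searchF : ℕ → ℕ → ℕ → ℕ
searchF zero k n = k
searchF (suc fuel) k n with suc (8 * n) ≤? (suc (2 * k)) ^ 2
... | yes _ = k
... | no _ = searchF fuel (suc k) n

f : ℕ → ℕ
f n = searchF (suc n) 0 n

-- g(n) = f(n)(f(n)+1)/2 - n   (the product is even, and it is ≥ n)
g : ℕ → ℕ
g n = (f n * (f n + 1)) / 2 ∸ n

iter : (ℕ → ℕ) → ℕ → ℕ → ℕ
iter h zero x = x
iter h (suc L) x = h (iter h L x)

{-# OPTIONS --safe #-}
module Submission where

open import Defs
open import Data.Nat.Base
open import Data.Nat.Properties
open import Data.Nat.DivMod using (_/_; m<n*o⇒m/o<n)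
open import Data.Nat.Tactic.RingSolver using (solve-∀)
open import Data.Product using (∃-syntax; _×_; _,_)
open import Data.Sum using (_⊎_; inj₁; inj₂)
open import Relation.Nullary using (¬_; yes; no)
open import Relation.Binary.PropositionalEquality

-- f n is the least k with n ≤ k(k+1)/2, so writing f n = j + 1 we have j(j+1)/2 < n and
-- g n = (j+1)(j+2)/2 − n ≤ j, whence g(n)² ≤ 2n.  An inequality h(m)² ≤ c·m survives
-- L-fold iteration as c·(hᴸ n)^(2ᴸ) ≤ c^(2ᴸ)·n: square the bound, then apply it once more.

^-distribʳ-* : ∀ m n o → (m * n) ^ o ≡ m ^ o * n ^ o
^-distribʳ-* m n zero    = refl
^-distribʳ-* m n (suc o) = begin
  m * n * (m * n) ^ o       ≡⟨ cong (m * n *_) (^-distribʳ-* m n o) ⟩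
  m * n * (m ^ o * n ^ o)   ≡⟨ interchange m n (m ^ o) (n ^ o) ⟩
  m * m ^ o * (n * n ^ o)   ∎
  where
  open ≡-Reasoning
  interchange : ∀ a b x y → a * b * (x * y) ≡ a * x * (b * y)
  interchange = solve-∀

iter-sqrt-bound : ∀ (h : ℕ → ℕ) c → (∀ m → h m ^ 2 ≤ c * m) →
                  ∀ L n → c * iter h L n ^ (2 ^ L) ≤ c ^ (2 ^ L) * n
iter-sqrt-bound h c h²≤cm zero    n rewrite *-identityʳ c | *-identityʳ n = ≤-refl
iter-sqrt-bound h c h²≤cm (suc L) n = begin
  c * h m ^ (2 * P)            ≡⟨ cong (c *_) (sym (^-*-assoc (h m) 2 P)) ⟩
  c * (h m ^ 2) ^ P            ≤⟨ *-monoʳ-≤ c (^-monoˡ-≤ P (h²≤cm m)) ⟩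
  c * (c * m) ^ P              ≡⟨ cong (c *_) (^-distribʳ-* c m P) ⟩
  c * (c ^ P * m ^ P)          ≡⟨ swap c (c ^ P) (m ^ P) ⟩
  c ^ P * (c * m ^ P)          ≤⟨ *-monoʳ-≤ (c ^ P) (iter-sqrt-bound h c h²≤cm L n) ⟩
  c ^ P * (c ^ P * n)          ≡⟨ sym (*-assoc (c ^ P) (c ^ P) n) ⟩
  c ^ P * c ^ P * n            ≡⟨ cong (_* n) (sym (^-distribˡ-+-* c P P)) ⟩
  c ^ (P + P) * n              ≡⟨ cong (λ e → c ^ (P + e) * n) (sym (+-identityʳ P)) ⟩
  c ^ (2 * P) * n              ∎
  where
  open ≤-Reasoning
  P = 2 ^ L
  m = iter h L n
  swap : ∀ a b x → a * (b * x) ≡ b * (a * x)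
  swap = solve-∀

Covers : ℕ → ℕ → Set
Covers n k = suc (8 * n) ≤ suc (2 * k) ^ 2

PredecessorFails : ℕ → ℕ → Set
PredecessorFails n k = k ≡ 0 ⊎ ∃[ j ] k ≡ suc j × ¬ Covers n j

searchF-predecessorFails : ∀ fuel k n → PredecessorFails n k → PredecessorFails n (searchF fuel k n)
searchF-predecessorFails zero       k n pf = pf
searchF-predecessorFails (suc fuel) k n pf with suc (8 * n) ≤? suc (2 * k) ^ 2
... | yes _    = pf
... | no ¬covk = searchF-predecessorFails fuel (suc k) n (inj₂ (k , refl , ¬covk))

f-predecessorFails : ∀ n → PredecessorFails n (f n)
f-predecessorFails n = searchF-predecessorFails (suc n) 0 n (inj₁ refl)

¬Covers⇒pronic< : ∀ n j → ¬ Covers n j → j * suc j < 2 * n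
¬Covers⇒pronic< n j ¬cov = *-cancelˡ-< 4 (j * suc j) (2 * n) (+-cancelˡ-< 1 _ _ (begin-strict
  1 + 4 * (j * suc j)   ≡⟨ odd-square j ⟨
  suc (2 * j) ^ 2       <⟨ ≰⇒> ¬cov ⟩
  suc (8 * n)           ≡⟨ cong suc (*-assoc 4 2 n) ⟩
  1 + 4 * (2 * n)       ∎))
  where
  open ≤-Reasoning
  odd-square : ∀ j → (1 + 2 * j) * ((1 + 2 * j) * 1) ≡ 1 + 4 * (j * (1 + j))
  odd-square = solve-∀

triangle-suc∸≤ : ∀ n j → j * suc j < 2 * n → suc j * (suc j + 1) / 2 ∸ n ≤ j
triangle-suc∸≤ n j jj<2n = begin
  suc j * (suc j + 1) / 2 ∸ n   ≤⟨ ∸-monoˡ-≤ n (+-cancelʳ-≤ 1 _ _ half<) ⟩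
  n + j ∸ n                     ≡⟨ m+n∸m≡n n j ⟩
  j                             ∎
  where
  open ≤-Reasoning
  pronic-suc : ∀ j → suc j * (suc j + 1) ≡ j * suc j + 2 * suc j
  pronic-suc = solve-∀
  double : ∀ n j → 2 * n + 2 * suc j ≡ (n + j + 1) * 2
  double = solve-∀
  twice< : suc j * (suc j + 1) < (n + j + 1) * 2
  twice< = begin-strict
    suc j * (suc j + 1)     ≡⟨ pronic-suc j ⟩
    j * suc j + 2 * suc j   <⟨ +-monoˡ-< (2 * suc j) jj<2n ⟩
    2 * n + 2 * suc j       ≡⟨ double n j ⟩
    (n + j + 1) * 2         ∎
  half< : suc j * (suc j + 1) / 2 + 1 ≤ n + j + 1
  half< = subst (_≤ n + j + 1) (+-comm 1 _) (m<n*o⇒m/o<n twice<)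

g²≤2n : ∀ n → g n ^ 2 ≤ 2 * n
g²≤2n n = bound (f n) (f-predecessorFails n)
  where
  bound : ∀ k → PredecessorFails n k → (k * (k + 1) / 2 ∸ n) ^ 2 ≤ 2 * n
  bound .0       (inj₁ refl) rewrite 0∸n≡0 n = z≤n
  bound .(suc j) (inj₂ (j , refl , ¬cov)) = begin
    (suc j * (suc j + 1) / 2 ∸ n) ^ 2   ≤⟨ ^-monoˡ-≤ 2 (triangle-suc∸≤ n j jj<2n) ⟩
    j * (j * 1)                         ≤⟨ *-monoʳ-≤ j (≤-trans (≤-reflexive (*-identityʳ j)) (n≤1+n j)) ⟩
    j * suc j                           <⟨ jj<2n ⟩
    2 * n                               ∎
    where
    open ≤-Reasoning
    jj<2n = ¬Covers⇒pronic< n j ¬cov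

proposition9 : ∀ (L n : ℕ) → 2 * (iter g L n) ^ (2 ^ L) ≤ 2 ^ (2 ^ L) * n
proposition9 = iter-sqrt-bound g 2 g²≤2n
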